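{- Let $n$ be a positive integer and $0\le s\le\lfloor n/2\rfloor$. Then: (i) $K_{n+3}^{(s+1)}(x)=x^2K_{n+2}^{(s+1)}(x)+xK_{n+1}^{(s)}(x)+K_n^{(s)}(x)$; (ii) $K_{n+3}^{(s)}(x)=x^2K_{n+2}^{(s)}(x)+xK_{n+1}^{(s)}(x)+K_n^{(s)}(x)-xB(n+1-s,s)(x)-B(n-s,s)(x)$.
   Context: Binomial coefficients satisfy $\binom{m}{k}=0$ for $k>m$. For integers $m>i\ge0$ define the polynomial $B(m,i)(x)=\sum_{j=0}^{i}\frac{m+i}{m-j}\binom{i}{j}\binom{m-j}{i}x^{2m-i-3j}$, and for $m\ge1$ define $B(m,m)(x)=2x^m$. For a positive integer $n$ and $0\le s\le\lfloor n/2\rfloor$, the incomplete Tribonacci-Lucas polynomial is $$K_n^{(s)}(x)=\sum_{i=0}^{s}B(n-i,i)(x)=\sum_{i=0}^{s}\ \sum_{\substack{0\le j\le i\\ i+j<n}}\frac{n}{n-i-j}\binom{i}{j}\binom{n-i-j}{i}x^{2n-3(i+j)}.$$ -}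

module Defs where

open import Data.Nat as ℕ using (ℕ; zero; suc; _∸_; _<?_; _≟_)
open import Data.Nat.Combinatorics using (_C_)
open import Data.Integer using (+_)
open import Data.Rational using (ℚ; 0ℚ; 1ℚ; _+_; _*_; _/_)
open import Relation.Nullary using (yes; no)

_^ℚ_ : ℚ → ℕ → ℚ
x ^ℚ zero  = 1ℚ
x ^ℚ suc k = x * (x ^ℚ k)

ℕ→ℚ : ℕ → ℚ
ℕ→ℚ a = + a / 1

-- a / b as a rational; only ever used with b > 0 (b = 0 gives 0, never reached)
ratio : ℕ → ℕ → ℚ
ratio a zero    = 0ℚ
ratio a (suc b) = + a / suc b

sumTo : ℕ → (ℕ → ℚ) → ℚ
sumTo zero    f = f 0
sumTo (suc k) f = sumTo k f + f (suc k)

-- B(m,i)(x): for m > i the sum formula; for i = m the value 2 x^m;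
-- (i > m is not defined in the paper and never used; set to 0).
B : ℕ → ℕ → ℚ → ℚ
B m i x with i <? m
... | yes _ = sumTo i (λ j →
        ratio (m ℕ.+ i) (m ∸ j) * ℕ→ℚ (i C j) * ℕ→ℚ ((m ∸ j) C i)
          * (x ^ℚ (2 ℕ.* m ∸ i ∸ 3 ℕ.* j)))
... | no _ with i ≟ m
...   | yes _ = ℕ→ℚ 2 * (x ^ℚ m)
...   | no _  = 0ℚ

K : ℕ → ℕ → ℚ → ℚ
K n s x = sumTo s (λ i → B (n ∸ i) i x)

module Submission where

-- With N = n-i-j, the monomial of index j in B(n-i,i) is A(N,i,j)·x^(2n-3(i+j)), where the
-- coefficient (N+i+j)/N·C(i,j)·C(N,i) is the natural number
--   A(N,i,j) = C(i,j)·(C(N,i) + C(N-1,i-1)) + C(i-1,j-1)·C(N-1,i-1)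
-- (coefficient-identity, from the absorption identity).  Pascal's rule gives the recurrence
-- A(N+1,i+1,j) = A(N,i+1,j) + A(N,i,j) + A(N,i,j-1) (A-recurrence), and every nonzero monomial
-- has the untruncated degree 2n-3(i+j) (support).  Monomial by monomial and then summed over j:
--   B(n+2-i,i+1) = x²·B(n+1-i,i+1) + x·B(n+1-i,i) + B(n-i,i)  and  B(n+3,0) = x²·B(n+2,0).
-- Summing over i ≤ s gives part (i); part (ii) is part (i) at s-1 with the top terms peeled off.

open import Defs
open import Data.Nat using (ℕ; _≤_; _∸_)
open import Data.Nat.DivMod using (_/_)
open import Data.Product using (_×_)
open import Relation.Binary.PropositionalEquality using (_≡_)

module Coefficients where
  open import Data.Nat using (zero; suc; pred; _+_; _*_; _<_; z≤n; s≤s; s≤s⁻¹; _≟_; _≤?_)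
  open import Data.Nat.Properties
  open import Data.Nat.DivMod using (_/_; m/n*n≤m)
  open import Data.Nat.Combinatorics using (_C_; nCk+nC[k+1]≡[n+1]C[k+1]; k>n⇒nCk≡0; nCn≡1; nC1≡n)
  open import Data.Nat.Solver using (module +-*-Solver)
  open import Data.Product using (_,_; proj₁; proj₂)
  open import Data.Sum using (_⊎_; inj₁; inj₂)
  open import Data.Empty using (⊥-elim)
  open import Relation.Nullary using (¬_; yes; no)
  open import Relation.Binary.PropositionalEquality
    using (refl; sym; trans; cong; cong₂; subst; _≢_; module ≡-Reasoning)
  open +-*-Solver using (solve; _:+_; _:*_; _:=_; con)

  -- C⁻ N i is the binomial coefficient C(N-1, i-1), taken to be 0 when N = 0 or i = 0.
  -- For N > 0 it equals (i/N)·C(N,i), the correction term in the coefficients of B.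
  C⁻ : ℕ → ℕ → ℕ
  C⁻ zero    _       = 0
  C⁻ (suc N) zero    = 0
  C⁻ (suc N) (suc i) = N C i

  C⁻-zeroʳ : ∀ N → C⁻ N 0 ≡ 0
  C⁻-zeroʳ zero    = refl
  C⁻-zeroʳ (suc N) = refl

  C⁻-vanishes : ∀ {N i} → N < i → C⁻ N i ≡ 0
  C⁻-vanishes {zero}              _        = refl
  C⁻-vanishes {suc N} {suc i} (s≤s N<i) = k>n⇒nCk≡0 N<i

  pascal : ∀ N i → suc N C i ≡ N C i + C⁻ (suc N) i
  pascal N zero    = refl
  pascal N (suc i) = trans (sym (nCk+nC[k+1]≡[n+1]C[k+1] N i)) (+-comm (N C i) (N C suc i))

  pascal⁻ : ∀ N i → ¬ (N ≡ 0 × i ≡ 0) → N C i ≡ C⁻ N (suc i) + C⁻ N i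
  pascal⁻ zero    zero    N,i≢0 = ⊥-elim (N,i≢0 (refl , refl))
  pascal⁻ zero    (suc i) _     = refl
  pascal⁻ (suc N) i       _     = pascal N i

  -- The same rule one level down, C⁻(i+1,j) = C⁻(i,j) + C⁻(i,j-1), weighted by C⁻ N i so that the exceptional
  -- case i = 0 (where C⁻ N 0 = 0) needs no hypothesis.
  pascal⁻-weighted : ∀ N i j → (C⁻ i j + C⁻ i (pred j)) * C⁻ N i ≡ C⁻ (suc i) j * C⁻ N i
  pascal⁻-weighted N zero    j       rewrite C⁻-zeroʳ N = sym (*-zeroʳ (C⁻ 1 j))
  pascal⁻-weighted N (suc i) zero    = refl
  pascal⁻-weighted N (suc i) (suc j) = cong (_* C⁻ N (suc i)) (sym (pascal i j))

  -- Absorption identity k·C(n,k) = n·C(n-1,k-1), in the shifted form used for induction.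
  absorption-suc : ∀ n k → suc k * (suc n C suc k) ≡ suc n * (n C k)
  absorption-suc zero    zero    = refl
  absorption-suc zero    (suc k) = *-zeroʳ (suc (suc k))
  absorption-suc (suc n) zero    = trans (*-identityˡ _) (trans (nC1≡n (suc (suc n))) (sym (*-identityʳ _)))
  absorption-suc (suc n) (suc k) = begin
      suc (suc k) * (suc (suc n) C suc (suc k))
    ≡⟨ cong (suc (suc k) *_) (sym (nCk+nC[k+1]≡[n+1]C[k+1] (suc n) (suc k))) ⟩
      suc (suc k) * (X + Y)
    ≡⟨ solve 3 (λ k X Y → (con 2 :+ k) :* (X :+ Y) := (con 1 :+ k) :* X :+ X :+ (con 2 :+ k) :* Y) refl k X Y ⟩
      suc k * X + X + suc (suc k) * Y
    ≡⟨ cong₂ (λ u v → u + X + v) (absorption-suc n k) (absorption-suc n (suc k)) ⟩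
      suc n * (n C k) + X + suc n * (n C suc k)
    ≡⟨ solve 4 (λ n a b X → (con 1 :+ n) :* a :+ X :+ (con 1 :+ n) :* b := (con 1 :+ n) :* (a :+ b) :+ X) refl n (n C k) (n C suc k) X ⟩
      suc n * (n C k + n C suc k) + X
    ≡⟨ cong (λ u → suc n * u + X) (nCk+nC[k+1]≡[n+1]C[k+1] n k) ⟩
      suc n * X + X
    ≡⟨ solve 2 (λ n X → (con 1 :+ n) :* X :+ X := (con 2 :+ n) :* X) refl n X ⟩
      suc (suc n) * X
    ∎
    where
    open ≡-Reasoning
    X Y : ℕ
    X = suc n C suc k
    Y = suc n C suc (suc k)

  absorption : ∀ N i → N * C⁻ N i ≡ i * (N C i)
  absorption zero    zero    = refl
  absorption zero    (suc i) = sym (*-zeroʳ (suc i))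
  absorption (suc N) zero    = *-zeroʳ (suc N)
  absorption (suc N) (suc i) = sym (absorption-suc N i)

  -- A N i j is the integer (N+i+j)/N · C(i,j) · C(N,i): the coefficient of the
  -- monomial of B(n-i,i) with index j, where N = n-i-j (see coefficient-identity).
  A : ℕ → ℕ → ℕ → ℕ
  A N i j = (i C j) * (N C i + C⁻ N i) + C⁻ i j * C⁻ N i

  A⁻ : ℕ → ℕ → ℕ → ℕ
  A⁻ N i zero    = 0
  A⁻ N i (suc j) = A N i j

  A⁻-expanded : ∀ N i j → A⁻ N i j ≡ C⁻ (suc i) j * (N C i + C⁻ N i) + C⁻ i (pred j) * C⁻ N i
  A⁻-expanded N zero    zero    = refl
  A⁻-expanded N (suc i) zero    = refl
  A⁻-expanded N i       (suc j) = refl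

  coefficient-identity : ∀ N i j → N * A N i j ≡ (N + i + j) * (i C j) * (N C i)
  coefficient-identity N i j = begin
      N * (a * (c + d) + e * d)
    ≡⟨ solve 5 (λ N a c d e → N :* (a :* (c :+ d) :+ e :* d) := N :* a :* c :+ (a :+ e) :* (N :* d)) refl N a c d e ⟩
      N * a * c + (a + e) * (N * d)
    ≡⟨ cong (λ u → N * a * c + (a + e) * u) (absorption N i) ⟩
      N * a * c + (a + e) * (i * c)
    ≡⟨ solve 5 (λ N i a c e → N :* a :* c :+ (a :+ e) :* (i :* c) := N :* a :* c :+ i :* a :* c :+ (i :* e) :* c) refl N i a c e ⟩
      N * a * c + i * a * c + (i * e) * c
    ≡⟨ cong (λ u → N * a * c + i * a * c + u * c) (absorption i j) ⟩
      N * a * c + i * a * c + (j * a) * c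
    ≡⟨ solve 5 (λ N i j a c → N :* a :* c :+ i :* a :* c :+ (j :* a) :* c := (N :+ i :+ j) :* a :* c) refl N i j a c ⟩
      (N + i + j) * a * c
    ∎
    where
    open ≡-Reasoning
    a c d e : ℕ
    a = i C j
    c = N C i
    d = C⁻ N i
    e = C⁻ i j

  -- The polynomial identity behind the recurrence, with the Pascal rules as hypotheses:
  -- b = C(i+1,j), c' = C(N+1,i+1), c = C(N,i), c₁ = C(N,i+1), d₀ = C⁻ N i, d₁ = C⁻ N (i+1).
  recurrence-algebra : ∀ a b c c' c₁ d₀ d₁ e e' p →
    b ≡ a + p → c' ≡ c + c₁ → c ≡ d₁ + d₀ → (e + e') * d₀ ≡ p * d₀ →
    b * (c' + c) + p * c
      ≡ (b * (c₁ + d₁) + p * d₁) + (a * (c + d₀) + e * d₀) + (p * (c + d₀) + e' * d₀)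
  recurrence-algebra a _ _ _ c₁ d₀ d₁ e e' p refl refl refl weighted = begin
      (a + p) * ((d₁ + d₀ + c₁) + (d₁ + d₀)) + p * (d₁ + d₀)
    ≡⟨ solve 5 (λ a p c₁ d₀ d₁ → (a :+ p) :* ((d₁ :+ d₀ :+ c₁) :+ (d₁ :+ d₀)) :+ p :* (d₁ :+ d₀)
                 := ((a :+ p) :* (c₁ :+ con 2 :* (d₁ :+ d₀)) :+ p :* d₁) :+ p :* d₀) refl a p c₁ d₀ d₁ ⟩
      ((a + p) * (c₁ + 2 * (d₁ + d₀)) + p * d₁) + p * d₀
    ≡⟨ cong (((a + p) * (c₁ + 2 * (d₁ + d₀)) + p * d₁) +_) (sym weighted) ⟩
      ((a + p) * (c₁ + 2 * (d₁ + d₀)) + p * d₁) + (e + e') * d₀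
    ≡⟨ solve 7 (λ a p c₁ d₀ d₁ e e' → ((a :+ p) :* (c₁ :+ con 2 :* (d₁ :+ d₀)) :+ p :* d₁) :+ (e :+ e') :* d₀
                 := ((a :+ p) :* (c₁ :+ d₁) :+ p :* d₁) :+ (a :* ((d₁ :+ d₀) :+ d₀) :+ e :* d₀)
                    :+ (p :* ((d₁ :+ d₀) :+ d₀) :+ e' :* d₀)) refl a p c₁ d₀ d₁ e e' ⟩
      ((a + p) * (c₁ + d₁) + p * d₁) + (a * ((d₁ + d₀) + d₀) + e * d₀) + (p * ((d₁ + d₀) + d₀) + e' * d₀)
    ∎
    where open ≡-Reasoning

  A-recurrence : ∀ N i j → ¬ (N ≡ 0 × i ≡ 0) →
    A (suc N) (suc i) j ≡ A N (suc i) j + A N i j + A⁻ N i j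
  A-recurrence N i j N,i≢0 rewrite A⁻-expanded N i j =
    recurrence-algebra (i C j) (suc i C j) (N C i) (suc N C suc i) (N C suc i) (C⁻ N i) (C⁻ N (suc i))
      (C⁻ i j) (C⁻ i (pred j)) (C⁻ (suc i) j)
      (pascal i j) (sym (nCk+nC[k+1]≡[n+1]C[k+1] N i)) (pascal⁻ N i N,i≢0) (pascal⁻-weighted N i j)

  A-vanishes-above : ∀ {N i} j → N < i → A N i j ≡ 0
  A-vanishes-above {N} {i} j N<i rewrite k>n⇒nCk≡0 N<i | C⁻-vanishes N<i =
    cong₂ _+_ (*-zeroʳ (i C j)) (*-zeroʳ (C⁻ i j))

  A-vanishes-right : ∀ N {i j} → i < j → A N i j ≡ 0
  A-vanishes-right N i<j rewrite k>n⇒nCk≡0 i<j | C⁻-vanishes i<j = refl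

  A-support : ∀ N i j → A N i j ≢ 0 → j ≤ i × i ≤ N
  A-support N i j A≢0 with j ≤? i | i ≤? N
  ... | yes j≤i | yes i≤N = j≤i , i≤N
  ... | no  j≰i | _       = ⊥-elim (A≢0 (A-vanishes-right N (≰⇒> j≰i)))
  ... | yes _   | no  i≰N = ⊥-elim (A≢0 (A-vanishes-above j (≰⇒> i≰N)))

  -- The coefficient 2 of the exceptional polynomial B(i,i) = 2x^i.
  A-diagonal : ∀ i → A (suc i) (suc i) 0 ≡ 2
  A-diagonal i rewrite nCn≡1 (suc i) | nCn≡1 i = refl

  degree : ℕ → ℕ → ℕ → ℕ
  degree m i j = 2 * (m ∸ i) ∸ i ∸ 3 * j

  degree-closed : ∀ m i j → degree m i j ≡ 2 * m ∸ 3 * (i + j)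
  degree-closed m i j = begin
      2 * (m ∸ i) ∸ i ∸ 3 * j
    ≡⟨ cong (λ t → t ∸ i ∸ 3 * j) (*-distribˡ-∸ 2 m i) ⟩
      2 * m ∸ 2 * i ∸ i ∸ 3 * j
    ≡⟨ cong (_∸ 3 * j) (∸-+-assoc (2 * m) (2 * i) i) ⟩
      2 * m ∸ (2 * i + i) ∸ 3 * j
    ≡⟨ ∸-+-assoc (2 * m) (2 * i + i) (3 * j) ⟩
      2 * m ∸ (2 * i + i + 3 * j)
    ≡⟨ cong (2 * m ∸_) (solve 2 (λ i j → con 2 :* i :+ i :+ con 3 :* j := con 3 :* (i :+ j)) refl i j) ⟩
      2 * m ∸ 3 * (i + j)
    ∎
    where open ≡-Reasoning

  degree-bound : ∀ m i j → j ≤ i → 2 * i + j ≤ m → 3 * (i + j) ≤ 2 * m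
  degree-bound m i j j≤i 2i+j≤m = begin
      3 * (i + j)
    ≡⟨ solve 2 (λ i j → con 3 :* (i :+ j) := (con 3 :* i :+ con 2 :* j) :+ j) refl i j ⟩
      (3 * i + 2 * j) + j
    ≤⟨ +-monoʳ-≤ (3 * i + 2 * j) j≤i ⟩
      (3 * i + 2 * j) + i
    ≡⟨ solve 2 (λ i j → (con 3 :* i :+ con 2 :* j) :+ i := con 2 :* (con 2 :* i :+ j)) refl i j ⟩
      2 * (2 * i + j)
    ≤⟨ *-monoʳ-≤ 2 2i+j≤m ⟩
      2 * m
    ∎
    where open ≤-Reasoning

  degree-exact : ∀ m i j → j ≤ i → 2 * i + j ≤ m → degree m i j + 3 * (i + j) ≡ 2 * m
  degree-exact m i j j≤i 2i+j≤m =
    trans (cong (_+ 3 * (i + j)) (degree-closed m i j)) (m∸n+n≡m (degree-bound m i j j≤i 2i+j≤m))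

  room : ∀ m i j → j ≤ i → i ≤ m ∸ i ∸ j → 2 * i + j ≤ m
  room m zero    _ z≤n _   = z≤n
  room m (suc i) j _   i≤N =
    subst (_≤ m) (solve 2 (λ i j → (con 1 :+ i) :+ ((con 1 :+ i) :+ j) := con 2 :* (con 1 :+ i) :+ j) refl i j)
          (m≤o∸n⇒m+n≤o (suc i) i+j≤m i≤m∸[i+j])
    where
    i≤m∸[i+j] : suc i ≤ m ∸ (suc i + j)
    i≤m∸[i+j] = subst (suc i ≤_) (∸-+-assoc m (suc i) j) i≤N
    i+j≤m : suc i + j ≤ m
    i+j≤m = <⇒≤ (m∸n≢0⇒n<m m∸[i+j]≢0)
      where
      m∸[i+j]≢0 : m ∸ (suc i + j) ≢ 0
      m∸[i+j]≢0 eq with subst (suc i ≤_) eq i≤m∸[i+j]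
      ... | ()

  support : ∀ m i j → A (m ∸ i ∸ j) i j ≡ 0 ⊎ degree m i j + 3 * (i + j) ≡ 2 * m
  support m i j with A (m ∸ i ∸ j) i j ≟ 0
  ... | yes A≡0 = inj₁ A≡0
  ... | no  A≢0 with A-support (m ∸ i ∸ j) i j A≢0
  ...   | j≤i , i≤N = inj₂ (degree-exact m i j j≤i (room m i j j≤i i≤N))

  aligned : ∀ {c c' e e' s s' m m'} k → (c ≡ 0 → c' ≡ 0) →
            c ≡ 0 ⊎ e + s ≡ m → c' ≡ 0 ⊎ e' + s' ≡ m' → m + s' ≡ k + m' + s →
            c' ≡ 0 ⊎ e ≡ k + e'
  aligned _ vanish (inj₁ c≡0) _            _ = inj₁ (vanish c≡0)
  aligned _ _      (inj₂ _)   (inj₁ c'≡0) _ = inj₁ c'≡0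
  aligned {e = e} {e'} {s} {s'} {m} {m'} k _ (inj₂ e+s≡m) (inj₂ e'+s'≡m') gap =
    inj₂ (+-cancelʳ-≡ (s + s') e (k + e') (begin
      e + (s + s')        ≡⟨ sym (+-assoc e s s') ⟩
      e + s + s'          ≡⟨ cong (_+ s') e+s≡m ⟩
      m + s'              ≡⟨ gap ⟩
      k + m' + s          ≡⟨ cong (λ t → k + t + s) (sym e'+s'≡m') ⟩
      k + (e' + s') + s   ≡⟨ solve 4 (λ k e' s s' → k :+ (e' :+ s') :+ s := (k :+ e') :+ (s :+ s')) refl k e' s s' ⟩
      (k + e') + (s + s') ∎))
    where open ≡-Reasoning

  step-coefficients : ∀ n i j → 1 ≤ n → 2 * i ≤ n → j ≤ suc i →
    A (3 + n ∸ suc i ∸ j) (suc i) j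
      ≡ A (2 + n ∸ suc i ∸ j) (suc i) j + A (1 + n ∸ i ∸ j) i j + A⁻ (1 + n ∸ i ∸ j) i j
  step-coefficients n i j 1≤n 2i≤n j≤1+i =
    trans (cong (λ N → A N (suc i) j) lower-index) (A-recurrence N i j N,i≢0)
    where
    N : ℕ
    N = 1 + n ∸ i ∸ j
    i+j≤1+n : i + j ≤ 1 + n
    i+j≤1+n = ≤-trans (+-monoʳ-≤ i j≤1+i)
                (subst (_≤ 1 + n) (sym (+-suc i i)) (s≤s (subst (_≤ n) (cong (i +_) (+-identityʳ i)) 2i≤n)))
    lower-index : 2 + n ∸ i ∸ j ≡ suc N
    lower-index = trans (cong (_∸ j) (+-∸-assoc 1 (≤-trans (m≤m+n i j) i+j≤1+n)))
                        (+-∸-assoc 1 (m+n≤o⇒m≤o∸n j (subst (_≤ 1 + n) (+-comm i j) i+j≤1+n)))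
    N,i≢0 : ¬ (N ≡ 0 × i ≡ 0)
    N,i≢0 (N≡0 , refl) with ≤-trans 1≤n (s≤s⁻¹ (≤-trans (m∸n≡0⇒m≤n N≡0) j≤1+i))
    ... | ()

  step-vanishes : ∀ n i j → 1 ≤ n → 2 * i ≤ n → j ≤ suc i → A (3 + n ∸ suc i ∸ j) (suc i) j ≡ 0 →
    A (2 + n ∸ suc i ∸ j) (suc i) j ≡ 0 × A (1 + n ∸ i ∸ j) i j ≡ 0 × A⁻ (1 + n ∸ i ∸ j) i j ≡ 0
  step-vanishes n i j 1≤n 2i≤n j≤1+i top≡0 =
    m+n≡0⇒m≡0 a (m+n≡0⇒m≡0 (a + b) sum≡0) , m+n≡0⇒n≡0 a (m+n≡0⇒m≡0 (a + b) sum≡0) , m+n≡0⇒n≡0 (a + b) sum≡0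
    where
    a b : ℕ
    a = A (2 + n ∸ suc i ∸ j) (suc i) j
    b = A (1 + n ∸ i ∸ j) i j
    sum≡0 : a + b + A⁻ (1 + n ∸ i ∸ j) i j ≡ 0
    sum≡0 = trans (sym (step-coefficients n i j 1≤n 2i≤n j≤1+i)) top≡0

  ≤-double : ∀ i → i ≤ 2 * i
  ≤-double i = m≤m+n i (i + 0)

  lowered-index : ∀ n i j → i ≤ n → 1 + n ∸ i ∸ suc j ≡ n ∸ i ∸ j
  lowered-index n i j i≤n = cong (_∸ suc j) (+-∸-assoc 1 i≤n)

  step-degree₂ : ∀ n i j → 1 ≤ n → 2 * i ≤ n → j ≤ suc i →
    A (2 + n ∸ suc i ∸ j) (suc i) j ≡ 0 ⊎ degree (3 + n) (suc i) j ≡ 2 + degree (2 + n) (suc i) j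
  step-degree₂ n i j 1≤n 2i≤n j≤1+i =
    aligned 2 (λ top≡0 → proj₁ (step-vanishes n i j 1≤n 2i≤n j≤1+i top≡0))
      (support (3 + n) (suc i) j) (support (2 + n) (suc i) j)
      (solve 3 (λ n i j → con 2 :* (con 3 :+ n) :+ con 3 :* ((con 1 :+ i) :+ j)
                      := con 2 :+ con 2 :* (con 2 :+ n) :+ con 3 :* ((con 1 :+ i) :+ j)) refl n i j)

  step-degree₁ : ∀ n i j → 1 ≤ n → 2 * i ≤ n → j ≤ suc i →
    A (1 + n ∸ i ∸ j) i j ≡ 0 ⊎ degree (3 + n) (suc i) j ≡ 1 + degree (1 + n) i j
  step-degree₁ n i j 1≤n 2i≤n j≤1+i =
    aligned 1 (λ top≡0 → proj₁ (proj₂ (step-vanishes n i j 1≤n 2i≤n j≤1+i top≡0)))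
      (support (3 + n) (suc i) j) (support (1 + n) i j)
      (solve 3 (λ n i j → con 2 :* (con 3 :+ n) :+ con 3 :* (i :+ j)
                      := con 1 :+ con 2 :* (con 1 :+ n) :+ con 3 :* ((con 1 :+ i) :+ j)) refl n i j)

  step-degree₀ : ∀ n i j → 1 ≤ n → 2 * i ≤ n → suc j ≤ suc i →
    A (n ∸ i ∸ j) i j ≡ 0 ⊎ degree (3 + n) (suc i) (suc j) ≡ 0 + degree n i j
  step-degree₀ n i j 1≤n 2i≤n j<1+i =
    aligned 0 (λ top≡0 → trans (cong (λ N → A N i j) (sym (lowered-index n i j (≤-trans (≤-double i) 2i≤n))))
                                (proj₂ (proj₂ (step-vanishes n i (suc j) 1≤n 2i≤n j<1+i top≡0))))
      (support (3 + n) (suc i) (suc j)) (support n i j)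
      (solve 3 (λ n i j → con 2 :* (con 3 :+ n) :+ con 3 :* (i :+ j)
                      := con 0 :+ con 2 :* n :+ con 3 :* ((con 1 :+ i) :+ (con 1 :+ j))) refl n i j)

  degree-base : ∀ n → degree (3 + n) 0 0 ≡ 2 + degree (2 + n) 0 0
  degree-base n = solve 1 (λ n → con 2 :* (con 3 :+ n) := con 2 :+ con 2 :* (con 2 :+ n)) refl n

  degree-diagonal : ∀ n i → n ∸ i ≡ i → degree n i 0 ≡ i
  degree-diagonal n i n∸i≡i = trans (cong (λ m → 2 * m ∸ i) n∸i≡i) (trans (m+n∸m≡n i (i + 0)) (+-identityʳ i))

  vanishes-off-diagonal : ∀ n i j → n ∸ i ≡ i → j < i → A (n ∸ i ∸ suc j) i (suc j) ≡ 0
  vanishes-off-diagonal n i j n∸i≡i j<i =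
    A-vanishes-above (suc j) (subst (λ m → m ∸ suc j < i) (sym n∸i≡i) (∸-monoʳ-< (s≤s z≤n) j<i))

  numerator-split : ∀ m i j → j ≤ m → m + i ≡ m ∸ j + i + j
  numerator-split m i j j≤m = begin
      m + i           ≡⟨ cong (_+ i) (sym (m∸n+n≡m j≤m)) ⟩
      m ∸ j + j + i   ≡⟨ +-assoc (m ∸ j) j i ⟩
      m ∸ j + (j + i) ≡⟨ cong (m ∸ j +_) (+-comm j i) ⟩
      m ∸ j + (i + j) ≡⟨ sym (+-assoc (m ∸ j) i j) ⟩
      m ∸ j + i + j   ∎
    where open ≡-Reasoning

  double-suc : ∀ {i n} → 2 * i ≤ n → 2 * suc i ≤ 2 + n
  double-suc {i} {n} 2i≤n = s≤s (subst (_≤ suc n) (sym (+-suc i (i + 0))) (s≤s 2i≤n))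

  double-≤ : ∀ {s n} → s ≤ n / 2 → 2 * s ≤ n
  double-≤ {s} {n} s≤n/2 = ≤-trans (*-monoʳ-≤ 2 s≤n/2) (subst (_≤ n) (*-comm (n / 2) 2) (m/n*n≤m n 2))

open Coefficients using (A; A⁻; degree; A-diagonal; A-vanishes-right; coefficient-identity;
  step-coefficients; step-degree₂; step-degree₁; step-degree₀; lowered-index; ≤-double;
  degree-base; degree-diagonal; vanishes-off-diagonal; numerator-split; double-suc; double-≤)

open import Data.Nat using (zero; suc; s≤s; z≤n; _<_; _<?_; _≟_)
import Data.Nat as ℕ
import Data.Nat.Properties as ℕₚ
open import Data.Nat.Combinatorics using (_C_)
import Data.Integer as ℤ
import Data.Integer.Properties as ℤₚ
open import Data.Rational using (ℚ; 0ℚ; _+_; _*_; _-_; toℚᵘ)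
import Data.Rational.Properties as ℚₚ
import Data.Rational.Unnormalised as ℚᵘ
import Data.Rational.Unnormalised.Properties as ℚᵘₚ
open import Data.Rational.Solver using (module +-*-Solver)
open import Data.Product using (_,_)
open import Data.Sum using (_⊎_; inj₁; inj₂)
open import Data.Empty using (⊥-elim)
open import Relation.Nullary using (yes; no)
open import Relation.Binary.PropositionalEquality
  using (refl; sym; trans; cong; cong₂; subst; module ≡-Reasoning)

open +-*-Solver using (solve; _:+_; _:*_; _:-_; _:=_)

-- Identities between rationals are verified on their unnormalised representatives,
-- where ℕ→ℚ k is the fraction k/1.
embed : ∀ k → toℚᵘ (ℕ→ℚ k) ℚᵘ.≃ ℚᵘ.mkℚᵘ (ℤ.+ k) 0
embed k = ℚₚ.toℚᵘ-fromℚᵘ (ℚᵘ.mkℚᵘ (ℤ.+ k) 0)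

ℕ→ℚ-+ : ∀ a b → ℕ→ℚ (a ℕ.+ b) ≡ ℕ→ℚ a + ℕ→ℚ b
ℕ→ℚ-+ a b = ℚₚ.toℚᵘ-injective (begin
    toℚᵘ (ℕ→ℚ (a ℕ.+ b))                         ≈⟨ embed (a ℕ.+ b) ⟩
    ℚᵘ.mkℚᵘ (ℤ.+ (a ℕ.+ b)) 0                     ≈⟨ ℚᵘ.*≡* integers ⟩
    ℚᵘ.mkℚᵘ (ℤ.+ a) 0 ℚᵘ.+ ℚᵘ.mkℚᵘ (ℤ.+ b) 0     ≈⟨ ℚᵘₚ.+-cong (ℚᵘₚ.≃-sym (embed a)) (ℚᵘₚ.≃-sym (embed b)) ⟩
    toℚᵘ (ℕ→ℚ a) ℚᵘ.+ toℚᵘ (ℕ→ℚ b)               ≈⟨ ℚᵘₚ.≃-sym (ℚₚ.toℚᵘ-homo-+ (ℕ→ℚ a) (ℕ→ℚ b)) ⟩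
    toℚᵘ (ℕ→ℚ a + ℕ→ℚ b)                         ∎)
  where
  open ℚᵘₚ.≃-Reasoning
  integers : ℤ.+ (a ℕ.+ b) ℤ.* ℤ.+ 1 ≡ (ℤ.+ a ℤ.* ℤ.+ 1 ℤ.+ ℤ.+ b ℤ.* ℤ.+ 1) ℤ.* ℤ.+ 1
  integers rewrite ℤₚ.*-identityʳ (ℤ.+ a) | ℤₚ.*-identityʳ (ℤ.+ b) = cong (ℤ._* ℤ.+ 1) (ℤₚ.pos-+ a b)

ratio-integral : ∀ P b u v w → suc b ℕ.* w ≡ P ℕ.* u ℕ.* v → ratio P (suc b) * ℕ→ℚ u * ℕ→ℚ v ≡ ℕ→ℚ w
ratio-integral P b u v w eq = ℚₚ.toℚᵘ-injective unnormalised
  where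
  integers : ℤ.+ P ℤ.* ℤ.+ u ℤ.* ℤ.+ v ℤ.* ℤ.+ 1 ≡ ℤ.+ w ℤ.* ℤ.+ (suc b ℕ.* 1 ℕ.* 1)
  integers = begin
      ℤ.+ P ℤ.* ℤ.+ u ℤ.* ℤ.+ v ℤ.* ℤ.+ 1  ≡⟨ ℤₚ.*-identityʳ _ ⟩
      ℤ.+ P ℤ.* ℤ.+ u ℤ.* ℤ.+ v            ≡⟨ cong (ℤ._* ℤ.+ v) (sym (ℤₚ.pos-* P u)) ⟩
      ℤ.+ (P ℕ.* u) ℤ.* ℤ.+ v              ≡⟨ sym (ℤₚ.pos-* (P ℕ.* u) v) ⟩
      ℤ.+ (P ℕ.* u ℕ.* v)                  ≡⟨ cong ℤ.+_ (trans (sym eq) (ℕₚ.*-comm (suc b) w)) ⟩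
      ℤ.+ (w ℕ.* suc b)                    ≡⟨ cong (λ d → ℤ.+ (w ℕ.* d)) (sym (trans (ℕₚ.*-identityʳ _) (ℕₚ.*-identityʳ _))) ⟩
      ℤ.+ (w ℕ.* (suc b ℕ.* 1 ℕ.* 1))      ≡⟨ ℤₚ.pos-* w _ ⟩
      ℤ.+ w ℤ.* ℤ.+ (suc b ℕ.* 1 ℕ.* 1)    ∎
    where open ≡-Reasoning
  unnormalised : toℚᵘ (ratio P (suc b) * ℕ→ℚ u * ℕ→ℚ v) ℚᵘ.≃ toℚᵘ (ℕ→ℚ w)
  unnormalised = begin
      toℚᵘ (ratio P (suc b) * ℕ→ℚ u * ℕ→ℚ v)
    ≈⟨ ℚₚ.toℚᵘ-homo-* (ratio P (suc b) * ℕ→ℚ u) (ℕ→ℚ v) ⟩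
      toℚᵘ (ratio P (suc b) * ℕ→ℚ u) ℚᵘ.* toℚᵘ (ℕ→ℚ v)
    ≈⟨ ℚᵘₚ.*-cong (ℚₚ.toℚᵘ-homo-* (ratio P (suc b)) (ℕ→ℚ u)) ℚᵘₚ.≃-refl ⟩
      toℚᵘ (ratio P (suc b)) ℚᵘ.* toℚᵘ (ℕ→ℚ u) ℚᵘ.* toℚᵘ (ℕ→ℚ v)
    ≈⟨ ℚᵘₚ.*-cong (ℚᵘₚ.*-cong (ℚₚ.toℚᵘ-fromℚᵘ (ℚᵘ.mkℚᵘ (ℤ.+ P) b)) (embed u)) (embed v) ⟩
      ℚᵘ.mkℚᵘ (ℤ.+ P) b ℚᵘ.* ℚᵘ.mkℚᵘ (ℤ.+ u) 0 ℚᵘ.* ℚᵘ.mkℚᵘ (ℤ.+ v) 0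
    ≈⟨ ℚᵘ.*≡* integers ⟩
      ℚᵘ.mkℚᵘ (ℤ.+ w) 0
    ≈⟨ ℚᵘₚ.≃-sym (embed w) ⟩
      toℚᵘ (ℕ→ℚ w)
    ∎
    where open ℚᵘₚ.≃-Reasoning

^-+ : ∀ x a b → x ^ℚ (a ℕ.+ b) ≡ x ^ℚ a * x ^ℚ b
^-+ x zero    b = sym (ℚₚ.*-identityˡ (x ^ℚ b))
^-+ x (suc a) b = trans (cong (x *_) (^-+ x a b)) (sym (ℚₚ.*-assoc x (x ^ℚ a) (x ^ℚ b)))

monomial-vanishes : ∀ {c} y → c ≡ 0 → ℕ→ℚ c * y ≡ 0ℚ
monomial-vanishes y refl = ℚₚ.*-zeroˡ y

shift-monomial : ∀ x {c} k d e → c ≡ 0 ⊎ e ≡ k ℕ.+ d → ℕ→ℚ c * x ^ℚ e ≡ x ^ℚ k * (ℕ→ℚ c * x ^ℚ d)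
shift-monomial x k d e (inj₁ c≡0) =
  trans (monomial-vanishes (x ^ℚ e) c≡0)
        (sym (trans (cong (x ^ℚ k *_) (monomial-vanishes (x ^ℚ d) c≡0)) (ℚₚ.*-zeroʳ (x ^ℚ k))))
shift-monomial x {c} k d _ (inj₂ refl) =
  trans (cong (ℕ→ℚ c *_) (^-+ x k d))
        (solve 3 (λ c u v → c :* (u :* v) := u :* (c :* v)) refl (ℕ→ℚ c) (x ^ℚ k) (x ^ℚ d))

monomial-split : ∀ a b c y → ℕ→ℚ (a ℕ.+ b ℕ.+ c) * y ≡ ℕ→ℚ a * y + ℕ→ℚ b * y + ℕ→ℚ c * y
monomial-split a b c y = begin
    ℕ→ℚ (a ℕ.+ b ℕ.+ c) * y           ≡⟨ cong (_* y) (trans (ℕ→ℚ-+ (a ℕ.+ b) c) (cong (_+ ℕ→ℚ c) (ℕ→ℚ-+ a b))) ⟩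
    (ℕ→ℚ a + ℕ→ℚ b + ℕ→ℚ c) * y       ≡⟨ ℚₚ.*-distribʳ-+ y (ℕ→ℚ a + ℕ→ℚ b) (ℕ→ℚ c) ⟩
    (ℕ→ℚ a + ℕ→ℚ b) * y + ℕ→ℚ c * y   ≡⟨ cong (_+ ℕ→ℚ c * y) (ℚₚ.*-distribʳ-+ y (ℕ→ℚ a) (ℕ→ℚ b)) ⟩
    ℕ→ℚ a * y + ℕ→ℚ b * y + ℕ→ℚ c * y ∎
  where open ≡-Reasoning

sumTo-cong : ∀ k {f g : ℕ → ℚ} → (∀ j → j ≤ k → f j ≡ g j) → sumTo k f ≡ sumTo k g
sumTo-cong zero    f≡g = f≡g 0 z≤n
sumTo-cong (suc k) f≡g = cong₂ _+_ (sumTo-cong k (λ j j≤k → f≡g j (ℕₚ.m≤n⇒m≤1+n j≤k))) (f≡g (suc k) ℕₚ.≤-refl)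

sumTo-shift : ∀ k f → sumTo (suc k) f ≡ f 0 + sumTo k (λ j → f (suc j))
sumTo-shift zero    f = refl
sumTo-shift (suc k) f = trans (cong (_+ f (suc (suc k))) (sumTo-shift k f)) (ℚₚ.+-assoc (f 0) _ (f (suc (suc k))))

sumTo-head : ∀ k f → (∀ j → j < k → f (suc j) ≡ 0ℚ) → sumTo k f ≡ f 0
sumTo-head zero    f _    = refl
sumTo-head (suc k) f tail = trans (cong₂ _+_ (sumTo-head k f (λ j j<k → tail j (ℕₚ.m<n⇒m<1+n j<k))) (tail k ℕₚ.≤-refl))
                                  (ℚₚ.+-identityʳ (f 0))

sumTo-combine : ∀ k a b f g h →
  sumTo k (λ j → a * f j + b * g j + h j) ≡ a * sumTo k f + b * sumTo k g + sumTo k h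
sumTo-combine zero    a b f g h = refl
sumTo-combine (suc k) a b f g h =
  trans (cong (_+ (a * f (suc k) + b * g (suc k) + h (suc k))) (sumTo-combine k a b f g h))
        (regroup a b (sumTo k f) (sumTo k g) (sumTo k h) (f (suc k)) (g (suc k)) (h (suc k)))
  where
  regroup : ∀ a b F G H u v w → (a * F + b * G + H) + (a * u + b * v + w) ≡ a * (F + u) + b * (G + v) + (H + w)
  regroup = solve 8 (λ a b F G H u v w → (a :* F :+ b :* G :+ H) :+ (a :* u :+ b :* v :+ w)
                                       := a :* (F :+ u) :+ b :* (G :+ v) :+ (H :+ w)) refl

term : ℚ → ℕ → ℕ → ℕ → ℚ
term x n i j = ℕ→ℚ (A (n ∸ i ∸ j) i j) * x ^ℚ degree n i j

term⁻ : ℚ → ℕ → ℕ → ℕ → ℚ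
term⁻ x n i zero    = 0ℚ
term⁻ x n i (suc j) = term x n i j

Bsum : ℚ → ℕ → ℕ → ℚ
Bsum x n i = sumTo i (term x n i)

B-coefficient : ∀ m i j → j < m →
  ratio (m ℕ.+ i) (m ∸ j) * ℕ→ℚ (i C j) * ℕ→ℚ ((m ∸ j) C i) ≡ ℕ→ℚ (A (m ∸ j) i j)
B-coefficient m i j j<m =
  trans (cong (λ P → ratio P (m ∸ j) * ℕ→ℚ (i C j) * ℕ→ℚ ((m ∸ j) C i)) (numerator-split m i j (ℕₚ.<⇒≤ j<m)))
        (integral (m ∸ j) (ℕₚ.m<n⇒0<n∸m j<m))
  where
  integral : ∀ N → 0 < N → ratio (N ℕ.+ i ℕ.+ j) N * ℕ→ℚ (i C j) * ℕ→ℚ (N C i) ≡ ℕ→ℚ (A N i j)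
  integral (suc b) _ = ratio-integral (suc b ℕ.+ i ℕ.+ j) b (i C j) (suc b C i) (A (suc b) i j) (coefficient-identity (suc b) i j)

B-diagonal : ∀ x n i → 1 ≤ n → n ∸ i ≡ i → Bsum x n i ≡ ℕ→ℚ 2 * x ^ℚ (n ∸ i)
B-diagonal x n zero    1≤n n≡0 with () ← ℕₚ.≤-trans 1≤n (ℕₚ.≤-reflexive n≡0)
B-diagonal x n (suc i) _   n∸i≡i = begin
    Bsum x n (suc i)
  ≡⟨ sumTo-head (suc i) (term x n (suc i)) (λ j j<i → monomial-vanishes _ (vanishes-off-diagonal n (suc i) j n∸i≡i j<i)) ⟩
    ℕ→ℚ (A (n ∸ suc i) (suc i) 0) * x ^ℚ degree n (suc i) 0
  ≡⟨ cong₂ (λ c d → ℕ→ℚ c * x ^ℚ d) (trans (cong (λ N → A N (suc i) 0) n∸i≡i) (A-diagonal i))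
                                    (trans (degree-diagonal n (suc i) n∸i≡i) (sym n∸i≡i)) ⟩
    ℕ→ℚ 2 * x ^ℚ (n ∸ suc i)
  ∎
  where open ≡-Reasoning

B-as-sum : ∀ x n i → 1 ≤ n → 2 ℕ.* i ≤ n → B (n ∸ i) i x ≡ Bsum x n i
B-as-sum x n i 1≤n 2i≤n with i <? n ∸ i
... | yes i<m = sumTo-cong i (λ j j≤i → cong (_* x ^ℚ degree n i j) (B-coefficient (n ∸ i) i j (ℕₚ.≤-<-trans j≤i i<m)))
... | no  i≮m with i ≟ n ∸ i
...   | yes i≡m = sym (B-diagonal x n i 1≤n (sym i≡m))
...   | no  i≢m = ⊥-elim (i≮m (ℕₚ.≤∧≢⇒< i≤m i≢m))
  where
  i≤m : i ≤ n ∸ i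
  i≤m = ℕₚ.m+n≤o⇒m≤o∸n i (subst (_≤ n) (cong (i ℕ.+_) (ℕₚ.+-identityʳ i)) 2i≤n)

term-recurrence : ∀ x n i j → 1 ≤ n → 2 ℕ.* i ≤ n → j ≤ suc i →
  term x (3 ℕ.+ n) (suc i) j ≡ x ^ℚ 2 * term x (2 ℕ.+ n) (suc i) j + x * term x (1 ℕ.+ n) i j + term⁻ x n i j
term-recurrence x n i j 1≤n 2i≤n j≤1+i = begin
    ℕ→ℚ (A (3 ℕ.+ n ∸ suc i ∸ j) (suc i) j) * x ^ℚ E
  ≡⟨ cong (λ c → ℕ→ℚ c * x ^ℚ E) (step-coefficients n i j 1≤n 2i≤n j≤1+i) ⟩
    ℕ→ℚ (c₂ ℕ.+ c₁ ℕ.+ c₀) * x ^ℚ E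
  ≡⟨ monomial-split c₂ c₁ c₀ (x ^ℚ E) ⟩
    ℕ→ℚ c₂ * x ^ℚ E + ℕ→ℚ c₁ * x ^ℚ E + ℕ→ℚ c₀ * x ^ℚ E
  ≡⟨ cong₂ _+_ (cong₂ _+_ (shift-monomial x 2 _ E (step-degree₂ n i j 1≤n 2i≤n j≤1+i))
                          (trans (shift-monomial x 1 _ E (step-degree₁ n i j 1≤n 2i≤n j≤1+i))
                                 (cong (_* term x (1 ℕ.+ n) i j) (ℚₚ.*-identityʳ x))))
               (lowest j j≤1+i) ⟩
    x ^ℚ 2 * term x (2 ℕ.+ n) (suc i) j + x * term x (1 ℕ.+ n) i j + term⁻ x n i j
  ∎
  where
  open ≡-Reasoning
  E c₂ c₁ c₀ : ℕ
  E  = degree (3 ℕ.+ n) (suc i) j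
  c₂ = A (2 ℕ.+ n ∸ suc i ∸ j) (suc i) j
  c₁ = A (1 ℕ.+ n ∸ i ∸ j) i j
  c₀ = A⁻ (1 ℕ.+ n ∸ i ∸ j) i j
  lowest : ∀ j → j ≤ suc i → ℕ→ℚ (A⁻ (1 ℕ.+ n ∸ i ∸ j) i j) * x ^ℚ degree (3 ℕ.+ n) (suc i) j ≡ term⁻ x n i j
  lowest zero    _     = ℚₚ.*-zeroˡ (x ^ℚ degree (3 ℕ.+ n) (suc i) 0)
  lowest (suc j) j<1+i =
    trans (cong (λ N → ℕ→ℚ (A N i j) * x ^ℚ degree (3 ℕ.+ n) (suc i) (suc j))
                (lowered-index n i j (ℕₚ.≤-trans (≤-double i) 2i≤n)))
          (trans (shift-monomial x 0 (degree n i j) _ (step-degree₀ n i j 1≤n 2i≤n j<1+i))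
                 (ℚₚ.*-identityˡ (term x n i j)))

-- Summing term-recurrence over j; the extra monomials (i, i+1) and (i, -1) are zero.
Bsum-recurrence : ∀ x n i → 1 ≤ n → 2 ℕ.* i ≤ n →
  Bsum x (3 ℕ.+ n) (suc i) ≡ x ^ℚ 2 * Bsum x (2 ℕ.+ n) (suc i) + x * Bsum x (1 ℕ.+ n) i + Bsum x n i
Bsum-recurrence x n i 1≤n 2i≤n = begin
    sumTo (suc i) (term x (3 ℕ.+ n) (suc i))
  ≡⟨ sumTo-cong (suc i) (λ j j≤1+i → term-recurrence x n i j 1≤n 2i≤n j≤1+i) ⟩
    sumTo (suc i) (λ j → x ^ℚ 2 * term x (2 ℕ.+ n) (suc i) j + x * term x (1 ℕ.+ n) i j + term⁻ x n i j)
  ≡⟨ sumTo-combine (suc i) (x ^ℚ 2) x (term x (2 ℕ.+ n) (suc i)) (term x (1 ℕ.+ n) i) (term⁻ x n i) ⟩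
    x ^ℚ 2 * Bsum x (2 ℕ.+ n) (suc i) + x * sumTo (suc i) (term x (1 ℕ.+ n) i) + sumTo (suc i) (term⁻ x n i)
  ≡⟨ cong₂ (λ u v → x ^ℚ 2 * Bsum x (2 ℕ.+ n) (suc i) + x * u + v) top-vanishes shifted ⟩
    x ^ℚ 2 * Bsum x (2 ℕ.+ n) (suc i) + x * Bsum x (1 ℕ.+ n) i + Bsum x n i
  ∎
  where
  open ≡-Reasoning
  top-vanishes : sumTo (suc i) (term x (1 ℕ.+ n) i) ≡ Bsum x (1 ℕ.+ n) i
  top-vanishes = trans (cong (λ t → Bsum x (1 ℕ.+ n) i + t) (monomial-vanishes (x ^ℚ degree (1 ℕ.+ n) i (suc i)) (A-vanishes-right _ (ℕₚ.n<1+n i))))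
                       (ℚₚ.+-identityʳ _)
  shifted : sumTo (suc i) (term⁻ x n i) ≡ Bsum x n i
  shifted = trans (sumTo-shift i (term⁻ x n i)) (ℚₚ.+-identityˡ _)

Bsum-base : ∀ x n → Bsum x (3 ℕ.+ n) 0 ≡ x ^ℚ 2 * Bsum x (2 ℕ.+ n) 0
Bsum-base x n = shift-monomial x {1} 2 (degree (2 ℕ.+ n) 0 0) (degree (3 ℕ.+ n) 0 0) (inj₂ (degree-base n))

B-base : ∀ x n → B (3 ℕ.+ n) 0 x ≡ x ^ℚ 2 * B (2 ℕ.+ n) 0 x
B-base x n = begin
    B (3 ℕ.+ n) 0 x          ≡⟨ B-as-sum x (3 ℕ.+ n) 0 (s≤s z≤n) z≤n ⟩
    Bsum x (3 ℕ.+ n) 0       ≡⟨ Bsum-base x n ⟩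
    x ^ℚ 2 * Bsum x (2 ℕ.+ n) 0 ≡⟨ cong (x ^ℚ 2 *_) (sym (B-as-sum x (2 ℕ.+ n) 0 (s≤s z≤n) z≤n)) ⟩
    x ^ℚ 2 * B (2 ℕ.+ n) 0 x ∎
  where open ≡-Reasoning

B-recurrence : ∀ x n i → 1 ≤ n → 2 ℕ.* i ≤ n →
  B (3 ℕ.+ n ∸ suc i) (suc i) x
    ≡ x ^ℚ 2 * B (2 ℕ.+ n ∸ suc i) (suc i) x + x * B (1 ℕ.+ n ∸ i) i x + B (n ∸ i) i x
B-recurrence x n i 1≤n 2i≤n = begin
    B (3 ℕ.+ n ∸ suc i) (suc i) x
  ≡⟨ B-as-sum x (3 ℕ.+ n) (suc i) (s≤s z≤n) (ℕₚ.m≤n⇒m≤1+n 2[i+1]≤2+n) ⟩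
    Bsum x (3 ℕ.+ n) (suc i)
  ≡⟨ Bsum-recurrence x n i 1≤n 2i≤n ⟩
    x ^ℚ 2 * Bsum x (2 ℕ.+ n) (suc i) + x * Bsum x (1 ℕ.+ n) i + Bsum x n i
  ≡⟨ sym (cong₂ _+_ (cong₂ (λ u v → x ^ℚ 2 * u + x * v)
                             (B-as-sum x (2 ℕ.+ n) (suc i) (s≤s z≤n) 2[i+1]≤2+n)
                             (B-as-sum x (1 ℕ.+ n) i (s≤s z≤n) (ℕₚ.m≤n⇒m≤1+n 2i≤n)))
                    (B-as-sum x n i 1≤n 2i≤n)) ⟩
    x ^ℚ 2 * B (2 ℕ.+ n ∸ suc i) (suc i) x + x * B (1 ℕ.+ n ∸ i) i x + B (n ∸ i) i x
  ∎
  where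
  open ≡-Reasoning
  2[i+1]≤2+n : 2 ℕ.* suc i ≤ 2 ℕ.+ n
  2[i+1]≤2+n = double-suc 2i≤n

K-recurrence : ∀ x n s → 1 ≤ n → 2 ℕ.* s ≤ n →
  K (3 ℕ.+ n) (suc s) x ≡ x ^ℚ 2 * K (2 ℕ.+ n) (suc s) x + x * K (1 ℕ.+ n) s x + K n s x
K-recurrence x n s 1≤n 2s≤n = begin
    K (3 ℕ.+ n) (suc s) x
  ≡⟨ sumTo-shift s (λ i → B (3 ℕ.+ n ∸ i) i x) ⟩
    B (3 ℕ.+ n) 0 x + sumTo s (λ i → B (3 ℕ.+ n ∸ suc i) (suc i) x)
  ≡⟨ cong₂ _+_ (B-base x n) (sumTo-cong s (λ i i≤s → B-recurrence x n i 1≤n (ℕₚ.≤-trans (ℕₚ.*-monoʳ-≤ 2 i≤s) 2s≤n))) ⟩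
    x ^ℚ 2 * B (2 ℕ.+ n) 0 x
      + sumTo s (λ i → x ^ℚ 2 * B (2 ℕ.+ n ∸ suc i) (suc i) x + x * B (1 ℕ.+ n ∸ i) i x + B (n ∸ i) i x)
  ≡⟨ cong (x ^ℚ 2 * B (2 ℕ.+ n) 0 x +_)
          (sumTo-combine s (x ^ℚ 2) x (λ i → B (2 ℕ.+ n ∸ suc i) (suc i) x) (λ i → B (1 ℕ.+ n ∸ i) i x) (λ i → B (n ∸ i) i x)) ⟩
    x ^ℚ 2 * B (2 ℕ.+ n) 0 x + (x ^ℚ 2 * S + x * K (1 ℕ.+ n) s x + K n s x)
  ≡⟨ regroup (x ^ℚ 2) x (B (2 ℕ.+ n) 0 x) S (K (1 ℕ.+ n) s x) (K n s x) ⟩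
    x ^ℚ 2 * (B (2 ℕ.+ n) 0 x + S) + x * K (1 ℕ.+ n) s x + K n s x
  ≡⟨ cong (λ u → x ^ℚ 2 * u + x * K (1 ℕ.+ n) s x + K n s x) (sym (sumTo-shift s (λ i → B (2 ℕ.+ n ∸ i) i x))) ⟩
    x ^ℚ 2 * K (2 ℕ.+ n) (suc s) x + x * K (1 ℕ.+ n) s x + K n s x
  ∎
  where
  open ≡-Reasoning
  S : ℚ
  S = sumTo s (λ i → B (2 ℕ.+ n ∸ suc i) (suc i) x)
  regroup : ∀ a y b S u v → a * b + (a * S + y * u + v) ≡ a * (b + S) + y * u + v
  regroup = solve 6 (λ a y b S u v → a :* b :+ (a :* S :+ y :* u :+ v) := a :* (b :+ S) :+ y :* u :+ v) refl

K-recurrence-truncated : ∀ x n s → 1 ≤ n → 2 ℕ.* s ≤ n →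
  K (3 ℕ.+ n) s x
    ≡ x ^ℚ 2 * K (2 ℕ.+ n) s x + x * K (1 ℕ.+ n) s x + K n s x - x * B (1 ℕ.+ n ∸ s) s x - B (n ∸ s) s x
-- For s = 0 this is B-base; otherwise part (i) at s - 1, since K_m^(s) = K_m^(s-1) + B(m-s,s).
K-recurrence-truncated x n zero    _   _   =
  trans (B-base x n) (sym (cancel (x ^ℚ 2 * B (2 ℕ.+ n) 0 x) (x * B (1 ℕ.+ n) 0 x) (B n 0 x)))
  where
  cancel : ∀ w y z → w + y + z - y - z ≡ w
  cancel = solve 3 (λ w y z → w :+ y :+ z :- y :- z := w) refl
K-recurrence-truncated x n (suc s) 1≤n 2[s+1]≤n =
  trans (K-recurrence x n s 1≤n (ℕₚ.≤-trans (ℕₚ.*-monoʳ-≤ 2 (ℕₚ.n≤1+n s)) 2[s+1]≤n))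
        (sym (cancel x (x ^ℚ 2 * K (2 ℕ.+ n) (suc s) x) (K (1 ℕ.+ n) s x) (K n s x)
                     (B (1 ℕ.+ n ∸ suc s) (suc s) x) (B (n ∸ suc s) (suc s) x)))
  where
  cancel : ∀ y w c d e f → w + y * (c + e) + (d + f) - y * e - f ≡ w + y * c + d
  cancel = solve 6 (λ y w c d e f → w :+ y :* (c :+ e) :+ (d :+ f) :- y :* e :- f
                                 := w :+ y :* c :+ d) refl

proposition2 : (n s : ℕ) → 1 ≤ n → s ≤ n / 2 → (x : ℚ) →
    (K (3 Data.Nat.+ n) (1 Data.Nat.+ s) x
      ≡ (x ^ℚ 2) * K (2 Data.Nat.+ n) (1 Data.Nat.+ s) x + x * K (1 Data.Nat.+ n) s x + K n s x)
    × (K (3 Data.Nat.+ n) s x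
      ≡ (x ^ℚ 2) * K (2 Data.Nat.+ n) s x + x * K (1 Data.Nat.+ n) s x + K n s x
          - x * B (1 Data.Nat.+ n ∸ s) s x - B (n ∸ s) s x)
proposition2 n s 1≤n s≤n/2 x =
  K-recurrence x n s 1≤n (double-≤ s≤n/2) , K-recurrence-truncated x n s 1≤n (double-≤ s≤n/2)
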